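{- For $k\in\{3,4\}$ and every integer $n>k$, $$f(n)^2-f(n-k)\,f(n+k)>0.$$
   Context: For a positive integer $m$, $f(m)$ denotes the number of nonempty subsets $A\subseteq\{1,2,\dots,m\}$ with $\gcd(A)=1$, where $\gcd(A)$ is the greatest common divisor of all elements of $A$. Equivalently, $f(m)=\sum_{d\le m}\mu(d)\left(2^{\lfloor m/d\rfloor}-1\right)$, with $\mu$ the Möbius function. -}

module Defs where

open import Data.Nat using (ℕ; zero; suc; _+_; _≟_)
open import Data.Nat.GCD using (gcd)
open import Data.List using (List; []; _∷_; map; _++_; length; filter; foldr)
open import Data.Bool using (true; false)
open import Relation.Nullary.Decidable using (⌊_⌋)

subsets : List ℕ → List (List ℕ)
subsets []       = [] ∷ []
subsets (x ∷ xs) = let s = subsets xs in map (x ∷_) s ++ s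

range1 : ℕ → List ℕ
range1 zero    = []
range1 (suc m) = range1 m ++ (suc m ∷ [])

-- gcd of all elements (gcd of the empty list is 0, the identity for gcd).
gcdList : List ℕ → ℕ
gcdList = foldr gcd 0

isGood : List ℕ → Data.Bool.Bool
isGood []      = false
isGood (x ∷ A) = ⌊ gcdList (x ∷ A) ≟ 1 ⌋

f : ℕ → ℕ
f m = length (filter (λ A → Relation.Nullary.Decidable.T? (isGood A)) (subsets (range1 m)))

module Submission where

-- Sorting the subsets of {1,…,m} by the divisibility of their elements, inclusion–exclusion
-- over the primes 2 and 3 gives  f m ≤ 2^m − 2^⌊m/2⌋ − 2^⌊m/3⌋ + 2^⌊m/6⌋,  and a union bound
-- over the primes p ≤ m gives  f m ≥ 2^m − 1 − Σₚ (2^⌊m/p⌋ − 1) ≥ 2^m − 2^⌊m/2⌋ − (m·2^⌊m/3⌋ + 1).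
-- Put K = 2^k and T = 2^⌊(n−k)/2⌋. For k ∈ {3,4} the upper bounds give
-- K²·f(n−k) + f(n+k) ≤ 2K·2^n − K(K+1)T, while the lower bound gives 2K·f(n) > 2K·2^n − K(K+1)T
-- once 8(n·2^⌊n/3⌋ + 1) < 2^⌊n/2⌋, which holds for n ≥ 52. AM–GM then yields
-- 4K²·f(n−k)·f(n+k) < (2K·f(n))². For n < 52 the two sharper bounds are compared by evaluation.

open import Defs
open import Data.Bool using (Bool; true; false; _∧_; not)
open import Data.Bool.ListAction using (all)
open import Data.Empty using (⊥-elim)
open import Data.Fin using (toℕ; fromℕ<)
open import Data.Fin.Properties using (all?; toℕ-fromℕ<)
open import Data.List using (List; []; _∷_; _++_; map; length; filter; null)
open import Data.List.Membership.Propositional using (_∈_)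
open import Data.List.Properties using (map-++; map-∘; map-cong; length-++)
open import Data.List.Relation.Unary.All as All using (All; []; _∷_)
import Data.List.Relation.Unary.All.Properties as All
open import Data.List.Relation.Unary.Any using (here; there)
import Data.List.Relation.Unary.Any.Properties as Any
open import Data.Nat
open import Data.Nat.Divisibility
open import Data.Nat.DivMod
open import Data.Nat.GCD using (gcd[m,n]∣m; gcd[m,n]∣n; gcd-greatest)
open import Data.Nat.Induction using (<-rec)
open import Data.Nat.LCM using (lcm-least)
open import Data.Nat.ListAction using (sum; product)
open import Data.Nat.ListAction.Properties using (sum-++)
open import Data.Nat.Primality using (Prime; prime?; prime⇒nonTrivial)
open import Data.Nat.Primality.Factorisation using (factorise)
open import Data.Nat.Properties
open import Data.Nat.Tactic.RingSolver using (solve-∀)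
open import Data.Product using (Σ; _×_; _,_; proj₁; proj₂)
open import Data.Sum using (_⊎_; inj₁; inj₂)
open import Function using (_∘_)
open import Relation.Binary.PropositionalEquality
open import Relation.Nullary using (Dec; yes; no; does)
open import Relation.Nullary.Decidable using (True; toWitness; _→-dec_; T?; dec-true)
open import Relation.Unary using (Decidable)

bit : Bool → ℕ
bit true  = 1
bit false = 0

bit≤1 : (b : Bool) → bit b ≤ 1
bit≤1 true  = ≤-refl
bit≤1 false = z≤n

∑ : {A : Set} → List A → (A → ℕ) → ℕ
∑ xs h = sum (map h xs)

module _ {A : Set} where

  ∑-++ : (xs ys : List A) (h : A → ℕ) → ∑ (xs ++ ys) h ≡ ∑ xs h + ∑ ys h
  ∑-++ xs ys h = trans (cong sum (map-++ h xs ys)) (sum-++ (map h xs) (map h ys))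

  ∑-zero : (xs : List A) → ∑ xs (λ _ → 0) ≡ 0
  ∑-zero []       = refl
  ∑-zero (_ ∷ xs) = ∑-zero xs

  ∑-cong : (xs : List A) {g h : A → ℕ} → (∀ x → g x ≡ h x) → ∑ xs g ≡ ∑ xs h
  ∑-cong xs g≗h = cong sum (map-cong g≗h xs)

  ∑-distrib-+ : (xs : List A) (g h : A → ℕ) → ∑ xs (λ x → g x + h x) ≡ ∑ xs g + ∑ xs h
  ∑-distrib-+ []       g h = refl
  ∑-distrib-+ (x ∷ xs) g h =
    trans (cong (g x + h x +_) (∑-distrib-+ xs g h)) (+-+-interchange (g x) (h x) _ _)
    where
    +-+-interchange : ∀ a b c d → a + b + (c + d) ≡ a + c + (b + d)
    +-+-interchange = solve-∀

  ∑-*-distribˡ : (xs : List A) (c : ℕ) (h : A → ℕ) → ∑ xs (λ x → c * h x) ≡ c * ∑ xs h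
  ∑-*-distribˡ []       c h = sym (*-zeroʳ c)
  ∑-*-distribˡ (x ∷ xs) c h =
    trans (cong (c * h x +_) (∑-*-distribˡ xs c h)) (sym (*-distribˡ-+ c (h x) _))

  ∑-mono-≤ : (xs : List A) {g h : A → ℕ} → All (λ x → g x ≤ h x) xs → ∑ xs g ≤ ∑ xs h
  ∑-mono-≤ []       []            = z≤n
  ∑-mono-≤ (x ∷ xs) (gx≤hx ∷ g≤h) = +-mono-≤ gx≤hx (∑-mono-≤ xs g≤h)

  ∈⇒≤∑ : {xs : List A} (h : A → ℕ) {x : A} → x ∈ xs → h x ≤ ∑ xs h
  ∈⇒≤∑ h (here refl)  = m≤m+n _ _
  ∈⇒≤∑ h (there x∈xs) = ≤-trans (∈⇒≤∑ h x∈xs) (m≤n+m _ _)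

∑-comm : {A B : Set} (xs : List A) (ys : List B) (h : A → B → ℕ) →
         ∑ xs (λ x → ∑ ys (h x)) ≡ ∑ ys (λ y → ∑ xs (λ x → h x y))
∑-comm []       ys h = sym (∑-zero ys)
∑-comm (x ∷ xs) ys h =
  trans (cong (∑ ys (h x) +_) (∑-comm xs ys h)) (sym (∑-distrib-+ ys (h x) _))

∑-range1-suc : (m : ℕ) (h : ℕ → ℕ) → ∑ (range1 (suc m)) h ≡ ∑ (range1 m) h + h (suc m)
∑-range1-suc m h = trans (∑-++ (range1 m) _ h) (cong (∑ (range1 m) h +_) (+-identityʳ (h (suc m))))

length-range1 : (m : ℕ) → length (range1 m) ≡ m
length-range1 zero    = refl
length-range1 (suc m) =
  trans (length-++ (range1 m)) (trans (cong (_+ 1) (length-range1 m)) (+-comm m 1))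

∈-range1 : {m p : ℕ} → 1 ≤ p → p ≤ m → p ∈ range1 m
∈-range1 {zero}  1≤p p≤0 = ⊥-elim (<⇒≱ 1≤p p≤0)
∈-range1 {suc m} 1≤p p≤1+m with m≤n⇒m<n∨m≡n p≤1+m
... | inj₁ p<1+m = Any.++⁺ˡ (∈-range1 1≤p (≤-pred p<1+m))
... | inj₂ refl  = Any.++⁺ʳ (range1 m) (here refl)

All-range1 : (m : ℕ) → All (λ x → 1 ≤ x × x ≤ m) (range1 m)
All-range1 zero    = []
All-range1 (suc m) = All.++⁺ (All.map (λ (1≤x , x≤m) → 1≤x , m≤n⇒m≤1+n x≤m) (All-range1 m))
                             ((s≤s z≤n , ≤-refl) ∷ [])

All-subsets : {P : ℕ → Set} {xs : List ℕ} → All P xs → All (All P) (subsets xs)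
All-subsets {xs = []}     []         = [] ∷ []
All-subsets {xs = x ∷ xs} (px ∷ pxs) =
  All.++⁺ (All.map⁺ (All.map (px ∷_) (All-subsets pxs))) (All-subsets pxs)

∑-subsets-∷ : (x : ℕ) (xs : List ℕ) (h : List ℕ → ℕ) →
              ∑ (subsets (x ∷ xs)) h ≡ ∑ (subsets xs) (λ A → h (x ∷ A)) + ∑ (subsets xs) h
∑-subsets-∷ x xs h = trans (∑-++ (map (x ∷_) (subsets xs)) (subsets xs) h)
                           (cong (λ s → sum s + ∑ (subsets xs) h) (sym (map-∘ (subsets xs))))

∑-subsets-1 : (xs : List ℕ) → ∑ (subsets xs) (λ _ → 1) ≡ 2 ^ length xs
∑-subsets-1 []       = refl
∑-subsets-1 (x ∷ xs) = begin
  ∑ (subsets (x ∷ xs)) (λ _ → 1)                      ≡⟨ ∑-subsets-∷ x xs _ ⟩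
  ∑ (subsets xs) (λ _ → 1) + ∑ (subsets xs) (λ _ → 1) ≡⟨ cong (λ s → s + s) (∑-subsets-1 xs) ⟩
  2 ^ length xs + 2 ^ length xs                       ≡⟨ cong (2 ^ length xs +_) (+-identityʳ _) ⟨
  2 ^ suc (length xs)                                 ∎
  where open ≡-Reasoning

∑-subsets-null : (xs : List ℕ) → ∑ (subsets xs) (bit ∘ null) ≡ 1
∑-subsets-null []       = refl
∑-subsets-null (x ∷ xs) = trans (∑-subsets-∷ x xs (bit ∘ null))
                                (cong₂ _+_ (∑-zero (subsets xs)) (∑-subsets-null xs))

∑-subsets-all : (q : ℕ → Bool) (xs : List ℕ) → ∑ (subsets xs) (bit ∘ all q) ≡ 2 ^ ∑ xs (bit ∘ q)
∑-subsets-all q []       = refl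
∑-subsets-all q (x ∷ xs) rewrite ∑-subsets-∷ x xs (bit ∘ all q) with q x
... | true  = begin
  ∑ (subsets xs) (bit ∘ all q) + ∑ (subsets xs) (bit ∘ all q)
    ≡⟨ cong (λ s → s + s) (∑-subsets-all q xs) ⟩
  2 ^ ∑ xs (bit ∘ q) + 2 ^ ∑ xs (bit ∘ q)
    ≡⟨ cong (2 ^ ∑ xs (bit ∘ q) +_) (+-identityʳ _) ⟨
  2 ^ suc (∑ xs (bit ∘ q))
    ∎
  where open ≡-Reasoning
... | false = trans (cong (_+ ∑ (subsets xs) (bit ∘ all q)) (∑-zero (subsets xs))) (∑-subsets-all q xs)

∑-subsets-nonempty-all : (q : ℕ → Bool) (xs : List ℕ) →
  ∑ (subsets xs) (λ A → bit (not (null A) ∧ all q A)) ≡ 2 ^ ∑ xs (bit ∘ q) ∸ 1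
∑-subsets-nonempty-all q xs = begin
  ∑ L nonemptyAll             ≡⟨ m+n∸n≡m _ 1 ⟨
  ∑ L nonemptyAll + 1 ∸ 1     ≡⟨ cong (_∸ 1) all≡nonemptyAll+1 ⟨
  ∑ L (bit ∘ all q) ∸ 1       ≡⟨ cong (_∸ 1) (∑-subsets-all q xs) ⟩
  2 ^ ∑ xs (bit ∘ q) ∸ 1      ∎
  where
  open ≡-Reasoning
  L = subsets xs
  nonemptyAll : List ℕ → ℕ
  nonemptyAll A = bit (not (null A) ∧ all q A)
  split : (A : List ℕ) → bit (all q A) ≡ nonemptyAll A + bit (null A)
  split []      = refl
  split (_ ∷ _) = sym (+-identityʳ _)
  all≡nonemptyAll+1 : ∑ L (bit ∘ all q) ≡ ∑ L nonemptyAll + 1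
  all≡nonemptyAll+1 = begin
    ∑ L (bit ∘ all q)                      ≡⟨ ∑-cong L split ⟩
    ∑ L (λ A → nonemptyAll A + bit (null A)) ≡⟨ ∑-distrib-+ L nonemptyAll (bit ∘ null) ⟩
    ∑ L nonemptyAll + ∑ L (bit ∘ null)       ≡⟨ cong (∑ L nonemptyAll +_) (∑-subsets-null xs) ⟩
    ∑ L nonemptyAll + 1                      ∎

∑-subsets-range1-1 : (m : ℕ) → ∑ (subsets (range1 m)) (λ _ → 1) ≡ 2 ^ m
∑-subsets-range1-1 m = trans (∑-subsets-1 (range1 m)) (cong (2 ^_) (length-range1 m))

_∣ᵇ_ : ℕ → ℕ → Bool
d ∣ᵇ x = does (d ∣? x)

multiples : ℕ → ℕ → ℕ
multiples d m = ∑ (range1 m) (bit ∘ (d ∣ᵇ_))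

[m+kn]/n≡m/n+k : ∀ m k n .{{_ : NonZero n}} → (m + k * n) / n ≡ m / n + k
[m+kn]/n≡m/n+k m k n = trans (+-distrib-/-∣ʳ m (divides-refl k)) (cong (m / n +_) (m*n/n≡m k n))

/-unique : ∀ {m q d} .{{_ : NonZero d}} → q * d ≤ m → m < suc q * d → m / d ≡ q
/-unique {m} {q} {d} qd≤m m<[1+q]d =
  ≤-antisym (≤-pred (m<n*o⇒m/o<n m<[1+q]d)) (subst (_≤ m / d) (m*n/n≡m q d) (/-monoˡ-≤ d qd≤m))

multiples-bounds : ∀ d .{{_ : NonZero d}} m → multiples d m * d ≤ m × m < suc (multiples d m) * d
multiples-bounds d zero    = z≤n , ≤-trans (>-nonZero⁻¹ d) (≤-reflexive (sym (+-identityʳ d)))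
multiples-bounds d (suc m) rewrite ∑-range1-suc m (bit ∘ (d ∣ᵇ_)) with multiples-bounds d m | d ∣? suc m
... | qd≤m , m<[1+q]d | no d∤1+m =
  ≤-trans (≤-reflexive (cong (_* d) (+-identityʳ q))) (m≤n⇒m≤1+n qd≤m) ,
  ≤∧≢⇒< (subst (λ r → suc m ≤ suc r * d) (sym (+-identityʳ q)) m<[1+q]d)
        (λ 1+m≡[1+q]d → d∤1+m (divides (suc (q + 0)) 1+m≡[1+q]d))
  where q = multiples d m
... | qd≤m , m<[1+q]d | yes (divides c 1+m≡cd) =
  ≤-reflexive [q+1]d≡1+m ,
  ≤-trans (m<n+m (suc m) (>-nonZero⁻¹ d)) (≤-reflexive (cong (d +_) (sym [q+1]d≡1+m)))
  where
  q = multiples d m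
  c≡1+q : c ≡ suc q
  c≡1+q = ≤-antisym (*-cancelʳ-≤ c (suc q) d (≤-trans (≤-reflexive (sym 1+m≡cd)) m<[1+q]d))
                    (*-cancelʳ-< d q c (≤-trans (s≤s qd≤m) (≤-reflexive 1+m≡cd)))
  [q+1]d≡1+m : (q + 1) * d ≡ suc m
  [q+1]d≡1+m = trans (cong (_* d) (trans (+-comm q 1) (sym c≡1+q))) (sym 1+m≡cd)

multiples≡/ : ∀ d .{{_ : NonZero d}} m → multiples d m ≡ m / d
multiples≡/ d m = sym (/-unique (proj₁ (multiples-bounds d m)) (proj₂ (multiples-bounds d m)))

∑-subsets-multiples : ∀ d .{{_ : NonZero d}} m →
                      ∑ (subsets (range1 m)) (bit ∘ all (d ∣ᵇ_)) ≡ 2 ^ (m / d)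
∑-subsets-multiples d m = trans (∑-subsets-all (d ∣ᵇ_) (range1 m)) (cong (2 ^_) (multiples≡/ d m))

gcdList-∣ : (A : List ℕ) → All (gcdList A ∣_) A
gcdList-∣ []      = []
gcdList-∣ (x ∷ A) =
  gcd[m,n]∣m x (gcdList A) ∷ All.map (∣-trans (gcd[m,n]∣n x (gcdList A))) (gcdList-∣ A)

all-∣ᵇ⇒∣gcdList : ∀ {d} A → all (d ∣ᵇ_) A ≡ true → d ∣ gcdList A
all-∣ᵇ⇒∣gcdList     []      _ = _ ∣0
all-∣ᵇ⇒∣gcdList {d} (x ∷ A) d∣A with d ∣? x
... | yes d∣x = gcd-greatest d∣x (all-∣ᵇ⇒∣gcdList A d∣A)

∣gcdList⇒all-∣ᵇ : ∀ {d} A → d ∣ gcdList A → all (d ∣ᵇ_) A ≡ true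
∣gcdList⇒all-∣ᵇ {d} A d∣gcd = All⇒all-∣ᵇ (All.map (∣-trans d∣gcd) (gcdList-∣ A))
  where
  All⇒all-∣ᵇ : ∀ {B} → All (d ∣_) B → all (d ∣ᵇ_) B ≡ true
  All⇒all-∣ᵇ []                  = refl
  All⇒all-∣ᵇ {x ∷ _} (d∣x ∷ d∣B) rewrite dec-true (d ∣? x) d∣x = All⇒all-∣ᵇ d∣B

isGood⇒gcdList≡1 : ∀ A → isGood A ≡ true → gcdList A ≡ 1
isGood⇒gcdList≡1 (x ∷ A) good with gcdList (x ∷ A) ≟ 1
... | yes gcd≡1 = gcd≡1

isGood⇒¬all-∣ᵇ : ∀ {d} → 2 ≤ d → ∀ A → isGood A ≡ true → all (d ∣ᵇ_) A ≡ false
isGood⇒¬all-∣ᵇ {d} 2≤d A good with all (d ∣ᵇ_) A in d∣A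
... | false = refl
... | true  = ⊥-elim (<⇒≢ 2≤d (sym (∣1⇒≡1 d∣1)))
  where
  d∣1 : d ∣ 1
  d∣1 = subst (d ∣_) (isGood⇒gcdList≡1 A good) (all-∣ᵇ⇒∣gcdList A d∣A)

bit-inclusion-exclusion : (g a b c : Bool) → (g ≡ true → a ≡ false) → (g ≡ true → b ≡ false) →
                          (a ≡ true → b ≡ true → c ≡ true) → bit g + bit a + bit b ≤ 1 + bit c
bit-inclusion-exclusion true  a     b     c g⇒¬a g⇒¬b _     rewrite g⇒¬a refl | g⇒¬b refl = s≤s z≤n
bit-inclusion-exclusion false true  true  c _    _    a∧b⇒c rewrite a∧b⇒c refl refl = ≤-refl
bit-inclusion-exclusion false true  false c _    _    _     = s≤s z≤n
bit-inclusion-exclusion false false true  c _    _    _     = s≤s z≤n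
bit-inclusion-exclusion false false false c _    _    _     = z≤n

good+2∣+3∣≤1+6∣ : (A : List ℕ) →
  bit (isGood A) + bit (all (2 ∣ᵇ_) A) + bit (all (3 ∣ᵇ_) A) ≤ 1 + bit (all (6 ∣ᵇ_) A)
good+2∣+3∣≤1+6∣ A = bit-inclusion-exclusion _ _ _ _
  (isGood⇒¬all-∣ᵇ (s≤s (s≤s z≤n)) A) (isGood⇒¬all-∣ᵇ (s≤s (s≤s z≤n)) A)
  (λ 2∣A 3∣A → ∣gcdList⇒all-∣ᵇ {6} A
     (lcm-least (all-∣ᵇ⇒∣gcdList {2} A 2∣A) (all-∣ᵇ⇒∣gcdList {3} A 3∣A)))

length-filter-T? : {A : Set} (p : A → Bool) (xs : List A) →
                   length (filter (T? ∘ p) xs) ≡ ∑ xs (bit ∘ p)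
length-filter-T? p []       = refl
length-filter-T? p (x ∷ xs) with p x
... | true  = cong suc (length-filter-T? p xs)
... | false = length-filter-T? p xs

f≡∑ : (m : ℕ) → f m ≡ ∑ (subsets (range1 m)) (bit ∘ isGood)
f≡∑ m = length-filter-T? isGood (subsets (range1 m))

f-upper : (m : ℕ) → f m + 2 ^ (m / 2) + 2 ^ (m / 3) ≤ 2 ^ m + 2 ^ (m / 6)
f-upper m = begin
  f m + 2 ^ (m / 2) + 2 ^ (m / 3)
    ≡⟨ cong₂ _+_ (cong₂ _+_ (sym (f≡∑ m)) (∑-subsets-multiples 2 m)) (∑-subsets-multiples 3 m) ⟨
  ∑ L good + ∑ L (all∣ 2) + ∑ L (all∣ 3)
    ≡⟨ cong (_+ ∑ L (all∣ 3)) (∑-distrib-+ L good (all∣ 2)) ⟨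
  ∑ L (λ A → good A + all∣ 2 A) + ∑ L (all∣ 3)
    ≡⟨ ∑-distrib-+ L _ (all∣ 3) ⟨
  ∑ L (λ A → good A + all∣ 2 A + all∣ 3 A)
    ≤⟨ ∑-mono-≤ L (All.tabulate λ {A} _ → good+2∣+3∣≤1+6∣ A) ⟩
  ∑ L (λ A → 1 + all∣ 6 A)
    ≡⟨ ∑-distrib-+ L (λ _ → 1) (all∣ 6) ⟩
  ∑ L (λ _ → 1) + ∑ L (all∣ 6)
    ≡⟨ cong₂ _+_ (∑-subsets-range1-1 m) (∑-subsets-multiples 6 m) ⟩
  2 ^ m + 2 ^ (m / 6)
    ∎
  where
  open ≤-Reasoning
  L = subsets (range1 m)
  good : List ℕ → ℕ
  good = bit ∘ isGood
  all∣ : ℕ → List ℕ → ℕ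
  all∣ d = bit ∘ all (d ∣ᵇ_)

f-upper-coarse : (m : ℕ) → f m + 2 ^ (m / 2) ≤ 2 ^ m
f-upper-coarse m = +-cancelʳ-≤ (2 ^ (m / 3)) _ _
  (≤-trans (f-upper m) (+-monoʳ-≤ (2 ^ m) (^-monoʳ-≤ 2 (/-monoʳ-≤ m (s≤s (s≤s (s≤s (z≤n {3}))))))))

isPrime : ℕ → Bool
isPrime d = does (prime? d)

∃-prime-∣ : ∀ n .{{_ : NonZero n}} → n ≢ 1 → Σ ℕ λ p → Prime p × p ∣ n
∃-prime-∣ n n≢1 with factorise n
... | record { factors = []     ; isFactorisation = n≡1 } = ⊥-elim (n≢1 n≡1)
... | record { factors = p ∷ ps ; isFactorisation = n≡p*ps ; factorsPrime = prime-p ∷ _ } =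
  p , prime-p , subst (p ∣_) (sym n≡p*ps) (m∣m*n (product ps))

-- A nonempty A with gcd g ≠ 1 is counted at any prime factor p of g, and p ≤ g ≤ min A ≤ m.
good+null+primeDivisors≥1 : (m : ℕ) (A : List ℕ) → All (λ x → 1 ≤ x × x ≤ m) A →
  1 ≤ bit (isGood A) + bit (null A) + ∑ (range1 m) (λ d → bit (isPrime d) * bit (not (null A) ∧ all (d ∣ᵇ_) A))
good+null+primeDivisors≥1 m []      _                 = s≤s z≤n
good+null+primeDivisors≥1 m (x ∷ A) ((1≤x , x≤m) ∷ _) with gcdList (x ∷ A) ≟ 1
... | yes _  = s≤s z≤n
... | no g≢1 = ≤-trans term≥1 (∈⇒≤∑ (λ d → bit (isPrime d) * bit (all (d ∣ᵇ_) (x ∷ A))) p∈range1)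
  where
  g = gcdList (x ∷ A)
  instance
    x≢0 : NonZero x
    x≢0 = >-nonZero 1≤x
    g≢0 : NonZero g
    g≢0 = ≢-nonZero λ g≡0 → ≢-nonZero⁻¹ x (0∣⇒≡0 (subst (_∣ x) g≡0 (gcd[m,n]∣m x (gcdList A))))
  p = proj₁ (∃-prime-∣ g g≢1)
  prime-p = proj₁ (proj₂ (∃-prime-∣ g g≢1))
  p∣g = proj₂ (proj₂ (∃-prime-∣ g g≢1))
  p∈range1 : p ∈ range1 m
  p∈range1 = ∈-range1 (<⇒≤ (nonTrivial⇒n>1 p {{prime⇒nonTrivial prime-p}}))
                      (≤-trans (∣⇒≤ p∣g) (≤-trans (∣⇒≤ (gcd[m,n]∣m x (gcdList A))) x≤m))
  term≥1 : 1 ≤ bit (isPrime p) * bit (all (p ∣ᵇ_) (x ∷ A))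
  term≥1 rewrite dec-true (prime? p) prime-p | ∣gcdList⇒all-∣ᵇ (x ∷ A) p∣g = ≤-refl

primeTerm : ℕ → ℕ → ℕ
primeTerm m d = bit (isPrime d) * (2 ^ multiples d m ∸ 1)

primeUnionBound : ℕ → ℕ
primeUnionBound m = ∑ (range1 m) (primeTerm m)

f-lower : (m : ℕ) → 2 ^ m ≤ f m + 1 + primeUnionBound m
f-lower m = begin
  2 ^ m
    ≡⟨ ∑-subsets-range1-1 m ⟨
  ∑ L (λ _ → 1)
    ≤⟨ ∑-mono-≤ L (All.map (good+null+primeDivisors≥1 m _) (All-subsets (All-range1 m))) ⟩
  ∑ L (λ A → good A + empty A + ∑ R (λ d → pr d * div d A))
    ≡⟨ ∑-distrib-+ L _ _ ⟩
  ∑ L (λ A → good A + empty A) + ∑ L (λ A → ∑ R (λ d → pr d * div d A))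
    ≡⟨ cong₂ _+_ (∑-distrib-+ L good empty) (∑-comm L R (λ A d → pr d * div d A)) ⟩
  ∑ L good + ∑ L empty + ∑ R (λ d → ∑ L (λ A → pr d * div d A))
    ≡⟨ cong (∑ L good + ∑ L empty +_) (∑-cong R λ d → ∑-*-distribˡ L (pr d) (div d)) ⟩
  ∑ L good + ∑ L empty + ∑ R (λ d → pr d * ∑ L (div d))
    ≡⟨ cong₂ _+_ (cong₂ _+_ (sym (f≡∑ m)) (∑-subsets-null R))
                 (∑-cong R λ d → cong (pr d *_) (∑-subsets-nonempty-all (d ∣ᵇ_) R)) ⟩
  f m + 1 + primeUnionBound m
    ∎
  where
  open ≤-Reasoning
  R = range1 m
  L = subsets R
  good empty : List ℕ → ℕ
  good  = bit ∘ isGood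
  empty = bit ∘ null
  pr : ℕ → ℕ
  pr = bit ∘ isPrime
  div : ℕ → List ℕ → ℕ
  div d A = bit (not (null A) ∧ all (d ∣ᵇ_) A)

primeTerm≤ : ∀ m d .{{_ : NonZero d}} → primeTerm m d ≤ 2 ^ (m / d)
primeTerm≤ m d = begin
  bit (isPrime d) * (2 ^ multiples d m ∸ 1)  ≤⟨ *-monoˡ-≤ _ (bit≤1 (isPrime d)) ⟩
  1 * (2 ^ multiples d m ∸ 1)                ≡⟨ *-identityˡ _ ⟩
  2 ^ multiples d m ∸ 1                      ≤⟨ m∸n≤m _ 1 ⟩
  2 ^ multiples d m                          ≡⟨ cong (2 ^_) (multiples≡/ d m) ⟩
  2 ^ (m / d)                                ∎
  where open ≤-Reasoning

∑-primeTerm≤ : ∀ m j → ∑ (range1 j) (primeTerm m) ≤ 2 ^ (m / 2) + j * 2 ^ (m / 3)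
∑-primeTerm≤ m 0 = z≤n
∑-primeTerm≤ m 1 = z≤n
∑-primeTerm≤ m 2 = ≤-trans (≤-reflexive (+-identityʳ _)) (≤-trans (primeTerm≤ m 2) (m≤m+n _ _))
∑-primeTerm≤ m (suc j@(suc (suc _))) = begin
  ∑ (range1 (suc j)) (primeTerm m)                  ≡⟨ ∑-range1-suc j (primeTerm m) ⟩
  ∑ (range1 j) (primeTerm m) + primeTerm m (suc j)  ≤⟨ +-mono-≤ (∑-primeTerm≤ m j) term≤ ⟩
  2 ^ (m / 2) + j * 2 ^ (m / 3) + 2 ^ (m / 3)       ≡⟨ +-assoc (2 ^ (m / 2)) _ _ ⟩
  2 ^ (m / 2) + (j * 2 ^ (m / 3) + 2 ^ (m / 3))     ≡⟨ cong (2 ^ (m / 2) +_) (+-comm (j * 2 ^ (m / 3)) _) ⟩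
  2 ^ (m / 2) + suc j * 2 ^ (m / 3)                 ∎
  where
  open ≤-Reasoning
  term≤ : primeTerm m (suc j) ≤ 2 ^ (m / 3)
  term≤ = ≤-trans (primeTerm≤ m (suc j)) (^-monoʳ-≤ 2 (/-monoʳ-≤ m (s≤s (s≤s (s≤s z≤n)))))

f-lower-coarse : (m : ℕ) → 2 ^ m ≤ f m + 2 ^ (m / 2) + (m * 2 ^ (m / 3) + 1)
f-lower-coarse m = ≤-trans (f-lower m)
  (≤-trans (+-monoʳ-≤ (f m + 1) (∑-primeTerm≤ m m)) (≤-reflexive (shuffle (f m) _ _)))
  where
  shuffle : ∀ a b c → a + 1 + (b + c) ≡ a + b + (c + 1)
  shuffle = solve-∀

[n+k]/2≡[n∸k]/2+k : ∀ {k n} → k ≤ n → (n + k) / 2 ≡ (n ∸ k) / 2 + k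
[n+k]/2≡[n∸k]/2+k {k} {n} k≤n = trans (cong (_/ 2) n+k≡[n∸k]+k*2) ([m+kn]/n≡m/n+k (n ∸ k) k 2)
  where
  twice : ∀ s k → s + k + k ≡ s + k * 2
  twice = solve-∀
  n+k≡[n∸k]+k*2 : n + k ≡ n ∸ k + k * 2
  n+k≡[n∸k]+k*2 = trans (cong (_+ k) (sym (m∸n+n≡m k≤n))) (twice (n ∸ k) k)

n/2≤[n∸k]/2+c : ∀ {k n} c → k ≤ n → k ≤ c * 2 → n / 2 ≤ (n ∸ k) / 2 + c
n/2≤[n∸k]/2+c {k} {n} c k≤n k≤2c = begin
  n / 2                  ≤⟨ /-monoˡ-≤ 2 n≤[n∸k]+2c ⟩
  (n ∸ k + c * 2) / 2    ≡⟨ [m+kn]/n≡m/n+k (n ∸ k) c 2 ⟩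
  (n ∸ k) / 2 + c        ∎
  where
  open ≤-Reasoning
  n≤[n∸k]+2c : n ≤ n ∸ k + c * 2
  n≤[n∸k]+2c = ≤-trans (≤-reflexive (sym (m∸n+n≡m k≤n))) (+-monoʳ-≤ (n ∸ k) k≤2c)

amgm : (p q : ℕ) → 4 * p * q ≤ (p + q) * (p + q)
amgm p q with ≤-total p q
... | inj₁ p≤q with m≤n⇒∃[o]m+o≡n p≤q
... | r , refl = ≤-trans (m≤m+n (4 * p * (p + r)) (r * r)) (≤-reflexive (sym (square p r)))
  where
  square : ∀ p r → (p + (p + r)) * (p + (p + r)) ≡ 4 * p * (p + r) + r * r
  square = solve-∀
amgm p q | inj₂ q≤p with m≤n⇒∃[o]m+o≡n q≤p
... | r , refl = ≤-trans (m≤m+n (4 * (q + r) * q) (r * r)) (≤-reflexive (sym (square q r)))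
  where
  square : ∀ q r → ((q + r) + q) * ((q + r) + q) ≡ 4 * (q + r) * q + r * r
  square = solve-∀

*<*-from-weighted-sum : (K : ℕ) {x y a : ℕ} → K * K * x + y < 2 * K * a → x * y < a * a
*<*-from-weighted-sum K {x} {y} {a} sum< = *-cancelˡ-< (4 * (K * K)) (x * y) (a * a) (begin-strict
  4 * (K * K) * (x * y)              ≡⟨ rearrange K x y ⟩
  4 * (K * K * x) * y                ≤⟨ amgm (K * K * x) y ⟩
  (K * K * x + y) * (K * K * x + y)  <⟨ *-mono-< sum< sum< ⟩
  (2 * K * a) * (2 * K * a)          ≡⟨ square K a ⟩
  4 * (K * K) * (a * a)              ∎)
  where
  open ≤-Reasoning
  rearrange : ∀ K x y → 4 * (K * K) * (x * y) ≡ 4 * (K * K * x) * y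
  rearrange = solve-∀
  square : ∀ K a → (2 * K * a) * (2 * K * a) ≡ 4 * (K * K) * (a * a)
  square = solve-∀

2B+2C<[K+1]T : ∀ {K T B C} → 8 ≤ K → B ≤ 4 * T → 8 * C < B → 2 * B + 2 * C < (K + 1) * T
2B+2C<[K+1]T {K} {T} {B} {C} 8≤K B≤4T 8C<B = *-cancelˡ-< 8 _ _ (begin-strict
  8 * (2 * B + 2 * C)   ≡⟨ e₁ B C ⟩
  16 * B + 2 * (8 * C)  <⟨ +-monoʳ-< (16 * B) (*-monoʳ-< 2 8C<B) ⟩
  16 * B + 2 * B        ≡⟨ e₂ B ⟩
  18 * B                ≤⟨ *-monoʳ-≤ 18 B≤4T ⟩
  18 * (4 * T)          ≡⟨ e₃ T ⟩
  8 * (9 * T)           ≤⟨ *-monoʳ-≤ 8 (*-monoˡ-≤ T (+-monoˡ-≤ 1 8≤K)) ⟩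
  8 * ((K + 1) * T)     ∎)
  where
  open ≤-Reasoning
  e₁ : ∀ B C → 8 * (2 * B + 2 * C) ≡ 16 * B + 2 * (8 * C)
  e₁ = solve-∀
  e₂ : ∀ B → 16 * B + 2 * B ≡ 18 * B
  e₂ = solve-∀
  e₃ : ∀ T → 18 * (4 * T) ≡ 8 * (9 * T)
  e₃ = solve-∀

weighted-sum-< : ∀ {K X T x y a B C} → 8 ≤ K → x + T ≤ X → y + K * T ≤ K * (K * X) →
                 K * X ≤ a + B + C → B ≤ 4 * T → 8 * C < B → K * K * x + y < 2 * K * a
weighted-sum-< {K} {X} {T} {x} {y} {a} {B} {C} 8≤K x+T≤X y+KT≤KKX KX≤a+B+C B≤4T 8C<B =
  +-cancelʳ-< (K * (2 * B + 2 * C)) (K * K * x + y) (2 * K * a) (begin-strict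
    K * K * x + y + K * (2 * B + 2 * C)  <⟨ +-monoʳ-< (K * K * x + y) (*-monoʳ-< K BC<T) ⟩
    K * K * x + y + K * ((K + 1) * T)    ≡⟨ regroup K x y T ⟩
    K * K * (x + T) + (y + K * T)        ≤⟨ +-mono-≤ (*-monoʳ-≤ (K * K) x+T≤X) y+KT≤KKX ⟩
    K * K * X + K * (K * X)              ≡⟨ double K X ⟩
    2 * K * (K * X)                      ≤⟨ *-monoʳ-≤ (2 * K) KX≤a+B+C ⟩
    2 * K * (a + B + C)                  ≡⟨ distribute K a B C ⟩
    2 * K * a + K * (2 * B + 2 * C)      ∎)
  where
  open ≤-Reasoning
  instance
    K≢0 : NonZero K
    K≢0 = >-nonZero (≤-trans (s≤s z≤n) 8≤K)
  BC<T : 2 * B + 2 * C < (K + 1) * T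
  BC<T = 2B+2C<[K+1]T {K} {T} {B} {C} 8≤K B≤4T 8C<B
  regroup : ∀ K x y T → K * K * x + y + K * ((K + 1) * T) ≡ K * K * (x + T) + (y + K * T)
  regroup = solve-∀
  double : ∀ K X → K * K * X + K * (K * X) ≡ 2 * K * (K * X)
  double = solve-∀
  distribute : ∀ K a B C → 2 * K * (a + B + C) ≡ 2 * K * a + K * (2 * B + 2 * C)
  distribute = solve-∀

decide-below : {P : ℕ → Set} (P? : Decidable P) (b : ℕ) → True (all? {n = b} (P? ∘ toℕ)) →
               ∀ {n} → n < b → P n
decide-below {P} P? b checked n<b = subst P (toℕ-fromℕ< n<b) (toWitness checked (fromℕ< n<b))

-- Passing from m to m + 6 multiplies the left side by less than 8 and the right side by exactly 8.
growth-step : ∀ m → 6 ≤ m → 8 * (m * 2 ^ (m / 3) + 1) < 2 ^ (m / 2) →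
              8 * ((m + 6) * 2 ^ ((m + 6) / 3) + 1) < 2 ^ ((m + 6) / 2)
growth-step m 6≤m growth-m = begin-strict
  8 * ((m + 6) * 2 ^ ((m + 2 * 3) / 3) + 1)  ≡⟨ cong (λ e → 8 * ((m + 6) * 2 ^ e + 1)) ([m+kn]/n≡m/n+k m 2 3) ⟩
  8 * ((m + 6) * 2 ^ (m / 3 + 2) + 1)        ≡⟨ cong (λ e → 8 * ((m + 6) * e + 1)) (^-distribˡ-+-* 2 (m / 3) 2) ⟩
  8 * ((m + 6) * (T * 4) + 1)                ≤⟨ *-monoʳ-≤ 8 left-factor≤ ⟩
  8 * (8 * (m * T + 1))                      <⟨ *-monoʳ-< 8 growth-m ⟩
  8 * 2 ^ (m / 2)                            ≡⟨ *-comm 8 (2 ^ (m / 2)) ⟩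
  2 ^ (m / 2) * 2 ^ 3                        ≡⟨ ^-distribˡ-+-* 2 (m / 2) 3 ⟨
  2 ^ (m / 2 + 3)                            ≡⟨ cong (2 ^_) ([m+kn]/n≡m/n+k m 3 2) ⟨
  2 ^ ((m + 3 * 2) / 2)                      ∎
  where
  open ≤-Reasoning
  T = 2 ^ (m / 3)
  expand : ∀ m T → (m + 6) * (T * 4) + 1 ≡ 4 * (m * T) + 4 * (6 * T) + 1
  expand = solve-∀
  collect : ∀ m T → 4 * (m * T) + 4 * (m * T) + 8 ≡ 8 * (m * T + 1)
  collect = solve-∀
  left-factor≤ : (m + 6) * (T * 4) + 1 ≤ 8 * (m * T + 1)
  left-factor≤ = begin
    (m + 6) * (T * 4) + 1          ≡⟨ expand m T ⟩
    4 * (m * T) + 4 * (6 * T) + 1  ≤⟨ +-mono-≤ (+-monoʳ-≤ (4 * (m * T)) (*-monoʳ-≤ 4 (*-monoˡ-≤ T 6≤m)))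
                                              (s≤s (z≤n {7})) ⟩
    4 * (m * T) + 4 * (m * T) + 8  ≡⟨ collect m T ⟩
    8 * (m * T + 1)                ∎

growth : ∀ n → 52 ≤ n → 8 * (n * 2 ^ (n / 3) + 1) < 2 ^ (n / 2)
growth = <-rec (λ n → 52 ≤ n → G n) go
  where
  G : ℕ → Set
  G n = 8 * (n * 2 ^ (n / 3) + 1) < 2 ^ (n / 2)
  go : ∀ n → (∀ {m} → m < n → 52 ≤ m → G m) → 52 ≤ n → G n
  go n rec 52≤n with n <? 58
  ... | yes n<58 = decide-below (λ n → 52 ≤? n →-dec 8 * (n * 2 ^ (n / 3) + 1) <? 2 ^ (n / 2)) 58 _ n<58 52≤n
  ... | no n≮58 =
    subst G (m∸n+n≡m 6≤n) (growth-step (n ∸ 6) (≤-trans (m≤m+n 6 46) 52≤n∸6) (rec n∸6<n 52≤n∸6))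
    where
    6≤n : 6 ≤ n
    6≤n = ≤-trans (m≤m+n 6 46) 52≤n
    52≤n∸6 : 52 ≤ n ∸ 6
    52≤n∸6 = ∸-monoˡ-≤ 6 (≮⇒≥ n≮58)
    n∸6<n : n ∸ 6 < n
    n∸6<n = ∸-monoʳ-< (s≤s z≤n) 6≤n

f-inequality-large : ∀ k n → 3 ≤ k → k ≤ 4 → 52 ≤ n → f (n ∸ k) * f (n + k) < f n * f n
f-inequality-large k n 3≤k k≤4 52≤n = *<*-from-weighted-sum K {a = f n}
  (weighted-sum-< {a = f n} {C = n * 2 ^ (n / 3) + 1} (^-monoʳ-≤ 2 3≤k)
     (f-upper-coarse s) y-bound a-bound B≤4T (growth n 52≤n))
  where
  K = 2 ^ k
  s = n ∸ k
  T = 2 ^ (s / 2)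
  k≤n : k ≤ n
  k≤n = ≤-trans k≤4 (≤-trans (m≤m+n 4 48) 52≤n)
  2^n≡K*2^s : 2 ^ n ≡ K * 2 ^ s
  2^n≡K*2^s = trans (cong (2 ^_) (sym (m∸n+n≡m k≤n))) (trans (^-distribˡ-+-* 2 s k) (*-comm (2 ^ s) K))
  y-bound : f (n + k) + K * T ≤ K * (K * 2 ^ s)
  y-bound = subst₂ (λ u v → f (n + k) + u ≤ v) 2^[[n+k]/2]≡K*T 2^[n+k]≡K*[K*2^s] (f-upper-coarse (n + k))
    where
    2^[[n+k]/2]≡K*T : 2 ^ ((n + k) / 2) ≡ K * T
    2^[[n+k]/2]≡K*T = trans (cong (2 ^_) (trans ([n+k]/2≡[n∸k]/2+k k≤n) (+-comm (s / 2) k)))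
                            (^-distribˡ-+-* 2 k (s / 2))
    2^[n+k]≡K*[K*2^s] : 2 ^ (n + k) ≡ K * (K * 2 ^ s)
    2^[n+k]≡K*[K*2^s] = trans (^-distribˡ-+-* 2 n k) (trans (*-comm (2 ^ n) K) (cong (K *_) 2^n≡K*2^s))
  a-bound : K * 2 ^ s ≤ f n + 2 ^ (n / 2) + (n * 2 ^ (n / 3) + 1)
  a-bound = subst (_≤ f n + 2 ^ (n / 2) + (n * 2 ^ (n / 3) + 1)) 2^n≡K*2^s (f-lower-coarse n)
  B≤4T : 2 ^ (n / 2) ≤ 4 * T
  B≤4T = ≤-trans (^-monoʳ-≤ 2 (n/2≤[n∸k]/2+c 2 k≤n k≤4))
                 (≤-reflexive (trans (^-distribˡ-+-* 2 (s / 2) 2) (*-comm T 4)))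

upperBound : ℕ → ℕ
upperBound m = 2 ^ m + 2 ^ (m / 6) ∸ (2 ^ (m / 2) + 2 ^ (m / 3))

lowerBound : ℕ → ℕ
lowerBound m = 2 ^ m ∸ (1 + primeUnionBound m)

f≤upperBound : ∀ m → f m ≤ upperBound m
f≤upperBound m = m+n≤o⇒m≤o∸n (f m) (≤-trans (≤-reflexive (sym (+-assoc (f m) _ _))) (f-upper m))

lowerBound≤f : ∀ m → lowerBound m ≤ f m
lowerBound≤f m = m≤n+o⇒m∸n≤o (2 ^ m) (1 + primeUnionBound m)
  (≤-trans (f-lower m) (≤-reflexive (rotate (f m) 1 _)))
  where
  rotate : ∀ a b c → a + b + c ≡ b + c + a
  rotate = solve-∀

bounds-separate : ∀ k → k ≡ 3 ⊎ k ≡ 4 → ∀ {n} → k < n → n < 52 →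
                  upperBound (n ∸ k) * upperBound (n + k) < lowerBound n * lowerBound n
bounds-separate k k≡3⊎4 k<n n<52 = decide-below separated? 52 (checked k≡3⊎4) n<52 k<n
  where
  separated? : ∀ n → Dec (k < n → upperBound (n ∸ k) * upperBound (n + k) < lowerBound n * lowerBound n)
  separated? n = k <? n →-dec upperBound (n ∸ k) * upperBound (n + k) <? lowerBound n * lowerBound n
  checked : k ≡ 3 ⊎ k ≡ 4 → True (all? {n = 52} (separated? ∘ toℕ))
  checked (inj₁ refl) = _
  checked (inj₂ refl) = _

f-inequality-small : ∀ k → k ≡ 3 ⊎ k ≡ 4 → ∀ n → k < n → n < 52 → f (n ∸ k) * f (n + k) < f n * f n
f-inequality-small k k≡3⊎4 n k<n n<52 =
  ≤-<-trans (*-mono-≤ (f≤upperBound (n ∸ k)) (f≤upperBound (n + k)))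
            (<-≤-trans (bounds-separate k k≡3⊎4 k<n n<52) (*-mono-≤ (lowerBound≤f n) (lowerBound≤f n)))

mainTheorem2 : (k : ℕ) → (k ≡ 3 ⊎ k ≡ 4) → (n : ℕ) → k < n →
    f (n ∸ k) * f (n + k) < f n * f n
mainTheorem2 k k≡3⊎4 n k<n with n <? 52
... | yes n<52 = f-inequality-small k k≡3⊎4 n k<n n<52
... | no n≮52  = f-inequality-large k n (3≤k k≡3⊎4) (k≤4 k≡3⊎4) (≮⇒≥ n≮52)
  where
  3≤k : k ≡ 3 ⊎ k ≡ 4 → 3 ≤ k
  3≤k (inj₁ refl) = ≤-refl
  3≤k (inj₂ refl) = n≤1+n 3
  k≤4 : k ≡ 3 ⊎ k ≡ 4 → k ≤ 4
  k≤4 (inj₁ refl) = n≤1+n 3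
  k≤4 (inj₂ refl) = ≤-refl
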